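{- Let $\mathbf{q}=(q_1,\ldots,q_d)\in\mathbb{Z}^d$ with $q_1,\ldots,q_d$ coprime, let $\alpha_1,\ldots,\alpha_d\in\mathbb{Z}$ with $\alpha_1q_1+\cdots+\alpha_dq_d=1$, and let $\mathbf{i}=(i_1,\ldots,i_d)\in\mathbb{Z}^d\setminus\mathbb{Z}\mathbf{q}$. Then for all $\ell\in\mathbb{Z}$, $$\gcd(\ell\mathbf{q}+\mathbf{i})=\gcd\big(\ell+\alpha_1i_1+\cdots+\alpha_di_d,\ \gcd(i_jq_k-i_kq_j : j,k\in\{1,\ldots,d\})\big),$$ and $\gcd(\ell\mathbf{q})=|\ell|$. In particular, the sequence $(\gcd(\ell\mathbf{q}+\mathbf{i}))_{\ell\in\mathbb{Z}}$ is periodic with period $\gcd(i_jq_k-i_kq_j : j,k\in\{1,\ldots,d\})$.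
   Context: For $\mathbf{x}=(x_1,\ldots,x_d)\in\mathbb{Z}^d$, $\gcd(\mathbf{x})=\gcd(x_1,\ldots,x_d)\ge0$. -}

module Defs where

open import Data.Nat using (ℕ; zero; suc)
open import Data.Fin using (Fin; zero; suc)
open import Data.Integer using (ℤ; +_; _+_; _*_; _-_)
open import Data.Integer.GCD using (gcd)

gcdᵥ : ∀ {n} → (Fin n → ℤ) → ℤ
gcdᵥ {zero}  x = + 0
gcdᵥ {suc n} x = gcd (x zero) (gcdᵥ (λ i → x (suc i)))

sumᵥ : ∀ {n} → (Fin n → ℤ) → ℤ
sumᵥ {zero}  x = + 0
sumᵥ {suc n} x = x zero + sumᵥ (λ i → x (suc i))

gcd₂ : ∀ {n} → (Fin n → Fin n → ℤ) → ℤ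
gcd₂ a = gcdᵥ (λ j → gcdᵥ (λ k → a j k))

affine : ∀ {n} → ℤ → (Fin n → ℤ) → (Fin n → ℤ) → (Fin n → ℤ)
affine ℓ q i = λ j → ℓ * q j + i j

minors : ∀ {n} → (Fin n → ℤ) → (Fin n → ℤ) → Fin n → Fin n → ℤ
minors q i j k = i j * q k - i k * q j

-- The Bézout vector α lets one reconstruct i from its projection α · i and the minors
-- M j k = i j q k - i k q j, namely  i j = (α · i) q j - Σₖ α k M k j.  Hence ℓ q + i has
-- exactly the common divisors of ℓ + α · i and of all minors (the minors of ℓ q + i
-- against q are those of i), which gives the gcd formula.  The minors all vanish only
-- when i = (α · i) q, and adding their gcd to ℓ + α · i does not change the gcd.
module Submission where

open import Data.Nat using (ℕ; zero; suc; z≤n; s≤s)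
import Data.Nat.Divisibility as ℕ
open import Data.Fin using (Fin; zero; suc)
open import Data.Integer using (ℤ; +_; -_; _+_; _-_; _*_; ∣_∣; _>_; 0ℤ; 1ℤ; +<+)
open import Data.Integer.Properties using (+-identityʳ; *-identityʳ; *-zeroʳ; *-distribˡ-+)
open import Data.Integer.Divisibility.Signed
  using (_∣_; ∣ᵤ⇒∣; ∣⇒∣ᵤ; ∣-refl; ∣-trans; m∣∣m∣; ∣m∣∣m; 0∣⇒≡0;
         ∣m∣n⇒∣m+n; ∣m∣n⇒∣m-n; ∣m+n∣n⇒∣m; ∣n⇒∣m*n; ∣m⇒∣m*n)
open import Data.Integer.GCD using (gcd; gcd[i,j]∣i; gcd[i,j]∣j; gcd-greatest)
open import Data.Integer.Tactic.RingSolver using (solve-∀)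
open import Data.Empty using (⊥-elim)
open import Data.Product using (_×_; ∃; _,_)
open import Relation.Binary.PropositionalEquality
  using (_≡_; _≢_; refl; sym; trans; cong; cong₂; subst; module ≡-Reasoning)
open import Relation.Nullary using (¬_)
open import Defs

open ≡-Reasoning

∣-antisym-nonneg : ∀ {a b} → a ≡ + ∣ a ∣ → b ≡ + ∣ b ∣ → a ∣ b → b ∣ a → a ≡ b
∣-antisym-nonneg a≥0 b≥0 a∣b b∣a =
  trans a≥0 (trans (cong +_ (ℕ.∣-antisym (∣⇒∣ᵤ a∣b) (∣⇒∣ᵤ b∣a))) (sym b≥0))

+n≢0⇒+n>0 : ∀ {n} → + n ≢ 0ℤ → + n > 0ℤ
+n≢0⇒+n>0 {zero}  +n≢0 = ⊥-elim (+n≢0 refl)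
+n≢0⇒+n>0 {suc n} _    = +<+ (s≤s z≤n)

gcd∣ˡ : ∀ a b → gcd a b ∣ a
gcd∣ˡ a b = ∣ᵤ⇒∣ (gcd[i,j]∣i a b)

gcd∣ʳ : ∀ a b → gcd a b ∣ b
gcd∣ʳ a b = ∣ᵤ⇒∣ (gcd[i,j]∣j a b)

∣gcd : ∀ {a b c} → c ∣ a → c ∣ b → c ∣ gcd a b
∣gcd {a} {b} {c} c∣a c∣b = ∣ᵤ⇒∣ (gcd-greatest {a} {b} {c} (∣⇒∣ᵤ c∣a) (∣⇒∣ᵤ c∣b))

gcd[a+b,b]≡gcd[a,b] : ∀ a b → gcd (a + b) b ≡ gcd a b
gcd[a+b,b]≡gcd[a,b] a b = ∣-antisym-nonneg refl refl
  (∣gcd (∣m+n∣n⇒∣m {m = a} (gcd∣ˡ (a + b) b) (gcd∣ʳ (a + b) b)) (gcd∣ʳ (a + b) b))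
  (∣gcd (∣m∣n⇒∣m+n {m = a} (gcd∣ˡ a b) (gcd∣ʳ a b)) (gcd∣ʳ a b))

gcdᵥ-nonneg : ∀ {n} (x : Fin n → ℤ) → gcdᵥ x ≡ + ∣ gcdᵥ x ∣
gcdᵥ-nonneg {zero}  x = refl
gcdᵥ-nonneg {suc n} x = refl

gcdᵥ∣ : ∀ {n} (x : Fin n → ℤ) j → gcdᵥ x ∣ x j
gcdᵥ∣ {suc n} x zero    = gcd∣ˡ (x zero) (gcdᵥ (λ j → x (suc j)))
gcdᵥ∣ {suc n} x (suc j) =
  ∣-trans (gcd∣ʳ (x zero) (gcdᵥ (λ j → x (suc j)))) (gcdᵥ∣ (λ j → x (suc j)) j)

gcdᵥ-greatest : ∀ {n c} (x : Fin n → ℤ) → (∀ j → c ∣ x j) → c ∣ gcdᵥ x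
gcdᵥ-greatest {zero}  x c∣x = ∣ᵤ⇒∣ (ℕ._∣0 _)
gcdᵥ-greatest {suc n} x c∣x = ∣gcd (c∣x zero) (gcdᵥ-greatest (λ j → x (suc j)) (λ j → c∣x (suc j)))

gcdᵥ-unique : ∀ {n g} (x : Fin n → ℤ) → g ≡ + ∣ g ∣ →
              (∀ j → g ∣ x j) → (∀ {c} → (∀ j → c ∣ x j) → c ∣ g) → gcdᵥ x ≡ g
gcdᵥ-unique x g≥0 g∣x greatest =
  ∣-antisym-nonneg (gcdᵥ-nonneg x) g≥0 (greatest (gcdᵥ∣ x)) (gcdᵥ-greatest x g∣x)

gcdᵥ≡0⇒≡0 : ∀ {n} (x : Fin n → ℤ) → gcdᵥ x ≡ 0ℤ → ∀ j → x j ≡ 0ℤ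
gcdᵥ≡0⇒≡0 x gcd≡0 j = 0∣⇒≡0 (subst (_∣ x j) gcd≡0 (gcdᵥ∣ x j))

gcdᵥ-pos : ∀ {n} (x : Fin n → ℤ) → ¬ (∀ j → x j ≡ 0ℤ) → gcdᵥ x > 0ℤ
gcdᵥ-pos x x≢0 = subst (_> 0ℤ) (sym (gcdᵥ-nonneg x))
  (+n≢0⇒+n>0 (λ gcd≡0 → x≢0 (gcdᵥ≡0⇒≡0 x (trans (gcdᵥ-nonneg x) gcd≡0))))

gcd₂∣ : ∀ {n} (a : Fin n → Fin n → ℤ) j k → gcd₂ a ∣ a j k
gcd₂∣ a j k = ∣-trans (gcdᵥ∣ (λ j → gcdᵥ (a j)) j) (gcdᵥ∣ (a j) k)

gcd₂-greatest : ∀ {n c} (a : Fin n → Fin n → ℤ) → (∀ j k → c ∣ a j k) → c ∣ gcd₂ a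
gcd₂-greatest a c∣a = gcdᵥ-greatest _ (λ j → gcdᵥ-greatest (a j) (c∣a j))

gcd₂-pos : ∀ {n} (a : Fin n → Fin n → ℤ) → ¬ (∀ j k → a j k ≡ 0ℤ) → gcd₂ a > 0ℤ
gcd₂-pos a a≢0 = gcdᵥ-pos _ (λ gcd≡0 → a≢0 (λ j → gcdᵥ≡0⇒≡0 (a j) (gcd≡0 j)))

sumᵥ-cong : ∀ {n} {x y : Fin n → ℤ} → (∀ j → x j ≡ y j) → sumᵥ x ≡ sumᵥ y
sumᵥ-cong {zero}  x≡y = refl
sumᵥ-cong {suc n} x≡y = cong₂ _+_ (x≡y zero) (sumᵥ-cong (λ j → x≡y (suc j)))

sumᵥ-+ : ∀ {n} (x y : Fin n → ℤ) → sumᵥ (λ j → x j + y j) ≡ sumᵥ x + sumᵥ y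
sumᵥ-+ {zero}  x y = refl
sumᵥ-+ {suc n} x y = begin
  x zero + y zero + sumᵥ (λ j → x (suc j) + y (suc j))
    ≡⟨ cong (_+_ (x zero + y zero)) (sumᵥ-+ (λ j → x (suc j)) (λ j → y (suc j))) ⟩
  x zero + y zero + (sumᵥ (λ j → x (suc j)) + sumᵥ (λ j → y (suc j)))
    ≡⟨ interchange (x zero) (y zero) _ _ ⟩
  x zero + sumᵥ (λ j → x (suc j)) + (y zero + sumᵥ (λ j → y (suc j))) ∎
  where
  interchange : ∀ a b c d → a + b + (c + d) ≡ a + c + (b + d)
  interchange = solve-∀

sumᵥ-* : ∀ {n} c (x : Fin n → ℤ) → sumᵥ (λ j → c * x j) ≡ c * sumᵥ x
sumᵥ-* {zero}  c x = sym (*-zeroʳ c)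
sumᵥ-* {suc n} c x = trans (cong (_+_ (c * x zero)) (sumᵥ-* c (λ j → x (suc j))))
                           (sym (*-distribˡ-+ c (x zero) _))

∣-sumᵥ : ∀ {n c} (x : Fin n → ℤ) → (∀ j → c ∣ x j) → c ∣ sumᵥ x
∣-sumᵥ {zero}  x c∣x = ∣ᵤ⇒∣ (ℕ._∣0 _)
∣-sumᵥ {suc n} x c∣x = ∣m∣n⇒∣m+n (c∣x zero) (∣-sumᵥ (λ j → x (suc j)) (λ j → c∣x (suc j)))

infix 8 _·_

_·_ : ∀ {n} → (Fin n → ℤ) → (Fin n → ℤ) → ℤ
α · x = sumᵥ (λ j → α j * x j)

·-congʳ : ∀ {n} (α : Fin n → ℤ) {x y : Fin n → ℤ} → (∀ j → x j ≡ y j) → α · x ≡ α · y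
·-congʳ α x≡y = sumᵥ-cong (λ j → cong (α j *_) (x≡y j))

·-distribˡ-+ : ∀ {n} (α x y : Fin n → ℤ) → α · (λ j → x j + y j) ≡ α · x + α · y
·-distribˡ-+ α x y = trans (sumᵥ-cong (λ j → *-distribˡ-+ (α j) (x j) (y j))) (sumᵥ-+ (λ j → α j * x j) (λ j → α j * y j))

·-*ʳ : ∀ {n} (α : Fin n → ℤ) c (x : Fin n → ℤ) → α · (λ j → c * x j) ≡ c * (α · x)
·-*ʳ α c x = trans (sumᵥ-cong (λ j → swap (α j) c (x j))) (sumᵥ-* c (λ j → α j * x j))
  where
  swap : ∀ a b c → a * (b * c) ≡ b * (a * c)
  swap = solve-∀

·-zeroʳ : ∀ {n} (α x : Fin n → ℤ) → (∀ j → x j ≡ 0ℤ) → α · x ≡ 0ℤ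
·-zeroʳ α x x≡0 = trans (·-congʳ α x≡0) (·-*ʳ α 0ℤ (λ _ → 0ℤ))

∣-· : ∀ {n c} (α x : Fin n → ℤ) → (∀ j → c ∣ x j) → c ∣ α · x
∣-· α x c∣x = ∣-sumᵥ _ (λ j → ∣n⇒∣m*n (α j) (c∣x j))

∣-minors : ∀ {n c} (q x : Fin n → ℤ) → (∀ j → c ∣ x j) → ∀ j k → c ∣ minors q x j k
∣-minors q x c∣x j k = ∣m∣n⇒∣m-n (∣m⇒∣m*n (q k) (c∣x j)) (∣m⇒∣m*n (q j) (c∣x k))

minors-affine : ∀ {n} ℓ (q i : Fin n → ℤ) j k → minors q (affine ℓ q i) j k ≡ minors q i j k
minors-affine ℓ q i j k = cancel ℓ (q j) (q k) (i j) (i k)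
  where
  cancel : ∀ ℓ a b x y → (ℓ * a + x) * b - (ℓ * b + y) * a ≡ x * b - y * a
  cancel = solve-∀

·-minors-column : ∀ {n} (α q i : Fin n → ℤ) j →
                  α · (λ k → minors q i k j) ≡ q j * (α · i) + (- i j) * (α · q)
·-minors-column α q i j = begin
  α · (λ k → minors q i k j)
    ≡⟨ ·-congʳ α (λ k → expand (i k) (q k) (q j) (i j)) ⟩
  α · (λ k → q j * i k + (- i j) * q k)
    ≡⟨ ·-distribˡ-+ α _ _ ⟩
  α · (λ k → q j * i k) + α · (λ k → (- i j) * q k)
    ≡⟨ cong₂ _+_ (·-*ʳ α (q j) i) (·-*ʳ α (- i j) q) ⟩
  q j * (α · i) + (- i j) * (α · q) ∎
  where
  expand : ∀ x y a b → x * a - b * y ≡ a * x + (- b) * y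
  expand = solve-∀

module _ {n} (q α : Fin n → ℤ) (α·q≡1 : α · q ≡ 1ℤ) where

  ·-scaled : ∀ ℓ → α · (λ j → ℓ * q j) ≡ ℓ
  ·-scaled ℓ = begin
    α · (λ j → ℓ * q j) ≡⟨ ·-*ʳ α ℓ q ⟩
    ℓ * (α · q)         ≡⟨ cong (ℓ *_) α·q≡1 ⟩
    ℓ * 1ℤ              ≡⟨ *-identityʳ ℓ ⟩
    ℓ                   ∎

  ·-affine : ∀ ℓ i → α · affine ℓ q i ≡ ℓ + α · i
  ·-affine ℓ i = trans (·-distribˡ-+ α _ i) (cong (_+ α · i) (·-scaled ℓ))

  reconstruct-from-minors : ∀ i j → i j ≡ (α · i) * q j - α · (λ k → minors q i k j)
  reconstruct-from-minors i j = sym (begin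
    s * q j - α · (λ k → minors q i k j)       ≡⟨ cong (_-_ (s * q j)) (·-minors-column α q i j) ⟩
    s * q j - (q j * s + (- i j) * (α · q))    ≡⟨ cong (λ t → s * q j - (q j * s + (- i j) * t)) α·q≡1 ⟩
    s * q j - (q j * s + (- i j) * 1ℤ)         ≡⟨ cancel s (q j) (i j) ⟩
    i j                                        ∎)
    where
    s = α · i
    cancel : ∀ s a x → s * a - (a * s + (- x) * 1ℤ) ≡ x
    cancel = solve-∀

  affine-from-minors : ∀ ℓ i j →
    affine ℓ q i j ≡ (ℓ + α · i) * q j - α · (λ k → minors q i k j)
  affine-from-minors ℓ i j = begin
    ℓ * q j + i j                   ≡⟨ cong (_+_ (ℓ * q j)) (reconstruct-from-minors i j) ⟩
    ℓ * q j + ((α · i) * q j - m)   ≡⟨ regroup ℓ (q j) (α · i) m ⟩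
    (ℓ + α · i) * q j - m           ∎
    where
    m = α · (λ k → minors q i k j)
    regroup : ∀ ℓ a s m → ℓ * a + (s * a - m) ≡ (ℓ + s) * a - m
    regroup = solve-∀

  gcdᵥ-scaled : ∀ ℓ → gcdᵥ (λ j → ℓ * q j) ≡ + ∣ ℓ ∣
  gcdᵥ-scaled ℓ = gcdᵥ-unique _ refl
    (λ j → ∣-trans (∣m∣∣m {ℓ}) (∣m⇒∣m*n (q j) ∣-refl))
    (λ c∣ℓq → ∣-trans (subst (_ ∣_) (·-scaled ℓ) (∣-· α _ c∣ℓq)) m∣∣m∣)

  gcdᵥ-affine : ∀ ℓ i → gcdᵥ (affine ℓ q i) ≡ gcd (ℓ + α · i) (gcd₂ (minors q i))
  gcdᵥ-affine ℓ i = gcdᵥ-unique _ refl g∣x greatest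
    where
    D = gcd₂ (minors q i)
    g = gcd (ℓ + α · i) D
    g∣x : ∀ j → g ∣ affine ℓ q i j
    g∣x j = subst (g ∣_) (sym (affine-from-minors ℓ i j))
      (∣m∣n⇒∣m-n (∣m⇒∣m*n (q j) (gcd∣ˡ (ℓ + α · i) D))
                 (∣-· α _ (λ k → ∣-trans (gcd∣ʳ (ℓ + α · i) D) (gcd₂∣ (minors q i) k j))))
    greatest : ∀ {c} → (∀ j → c ∣ affine ℓ q i j) → c ∣ g
    greatest c∣x = ∣gcd
      (subst (_ ∣_) (·-affine ℓ i) (∣-· α _ c∣x))
      (gcd₂-greatest _ (λ j k → subst (_ ∣_) (minors-affine ℓ q i j k) (∣-minors q _ c∣x j k)))

  minors≡0⇒∈ℤq : ∀ i → (∀ j k → minors q i j k ≡ 0ℤ) → ∃ λ m → ∀ j → i j ≡ m * q j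
  minors≡0⇒∈ℤq i minors≡0 = α · i , λ j → begin
    i j                                          ≡⟨ reconstruct-from-minors i j ⟩
    (α · i) * q j - α · (λ k → minors q i k j)   ≡⟨ cong (_-_ ((α · i) * q j)) (·-zeroʳ α _ (λ k → minors≡0 k j)) ⟩
    (α · i) * q j - 0ℤ                           ≡⟨ +-identityʳ _ ⟩
    (α · i) * q j                                ∎

  gcdᵥ-affine-periodic : ∀ ℓ i →
    gcdᵥ (affine (ℓ + gcd₂ (minors q i)) q i) ≡ gcdᵥ (affine ℓ q i)
  gcdᵥ-affine-periodic ℓ i = begin
    gcdᵥ (affine (ℓ + D) q i)   ≡⟨ gcdᵥ-affine (ℓ + D) i ⟩
    gcd (ℓ + D + α · i) D       ≡⟨ cong (λ t → gcd t D) (reorder ℓ D (α · i)) ⟩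
    gcd (ℓ + α · i + D) D       ≡⟨ gcd[a+b,b]≡gcd[a,b] (ℓ + α · i) D ⟩
    gcd (ℓ + α · i) D           ≡⟨ gcdᵥ-affine ℓ i ⟨
    gcdᵥ (affine ℓ q i)         ∎
    where
    D = gcd₂ (minors q i)
    reorder : ∀ a b c → a + b + c ≡ a + c + b
    reorder = solve-∀

lemma4p1 : (d : ℕ) (q α i : Fin d → ℤ)
    → gcdᵥ q ≡ + 1
    → sumᵥ (λ j → α j * q j) ≡ + 1
    → ¬ (∃ λ (m : ℤ) → ∀ j → i j ≡ m * q j)
    → (∀ (ℓ : ℤ) → gcdᵥ (affine ℓ q i)
          ≡ gcd (ℓ + sumᵥ (λ j → α j * i j)) (gcd₂ (minors q i)))
      × (∀ (ℓ : ℤ) → gcdᵥ (λ j → ℓ * q j) ≡ + ∣ ℓ ∣)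
      × (gcd₂ (minors q i) > + 0)
      × (∀ (ℓ : ℤ) → gcdᵥ (affine (ℓ + gcd₂ (minors q i)) q i) ≡ gcdᵥ (affine ℓ q i))
lemma4p1 d q α i _ α·q≡1 i∉ℤq =
    (λ ℓ → gcdᵥ-affine q α α·q≡1 ℓ i)
  , gcdᵥ-scaled q α α·q≡1
  , gcd₂-pos (minors q i) (λ minors≡0 → i∉ℤq (minors≡0⇒∈ℤq q α α·q≡1 i minors≡0))
  , (λ ℓ → gcdᵥ-affine-periodic q α α·q≡1 ℓ i)
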